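{- Let $U$ be a ground set with $|U| = n$, let $\mathcal{F} \subseteq 2^U$ be any family, and let $w^* \in \mathbb{Z}^U$ be an unknown integer weight function with $|w^*_e| \le B$ for all $e \in U$. Then one can sort the feasible sets $S \in \mathcal{F}$ according to their weight $w^*(S)$, and hence find $\arg\min_{S \in \mathcal{F}} w^*(S)$, using $O(nB \log (nB))$ comparison queries. More precisely, the number of comparison queries required is $O((n + C)\log C)$, where $C = |\{w^*(S) : S \in \mathcal{F}\}|$ is the number of distinct weight values realized by feasible sets.
   Context: $w^*(S) := \sum_{e \in S} w^*_e$. A comparison query takes $S, T \in \mathcal{F}$ and reveals whether $w^*(S) <, =, >$ $w^*(T)$. Only queries are counted, not computation time. -}

module Defs where

open import Data.Nat using (ℕ; zero; suc)
open import Data.Bool using (Bool; true; false; if_then_else_)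
open import Data.Integer as ℤ using (ℤ; 0ℤ)
open import Data.Integer.Properties using (<-cmp)
open import Data.Fin using (Fin) renaming (zero to fzero; suc to fsuc)
open import Data.Fin.Subset using (Subset)
open import Data.Vec using (Vec; []; _∷_)
open import Data.List using (List; length; lookup)
open import Relation.Binary.Definitions using (tri<; tri≈; tri>)

weight : ∀ {n} → (Fin n → ℤ) → Subset n → ℤ
weight {zero}  w []      = 0ℤ
weight {suc n} w (b ∷ S) =
  (if b then w fzero else 0ℤ) ℤ.+ weight (λ i → w (fsuc i)) S

data Outcome : Set where
  lt eq gt : Outcome

compareℤ : ℤ → ℤ → Outcome
compareℤ x y with <-cmp x y
... | tri< _ _ _ = lt
... | tri≈ _ _ _ = eq
... | tri> _ _ _ = gt

-- Adaptive comparison-query algorithm (decision tree) for the family F.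
-- Each internal node queries a pair S, T ∈ F (given by positions in F) and
-- branches on the answer; each leaf outputs a list of sets (the claimed sorted order).
data Tree {n : ℕ} (F : List (Subset n)) : Set where
  leaf  : List (Subset n) → Tree F
  query : Fin (length F) → Fin (length F) → (Outcome → Tree F) → Tree F

run : ∀ {n} {F : List (Subset n)} → Tree F → (Fin n → ℤ) → List (Subset n)
run (leaf out)    w = out
run {F = F} (query i j k) w =
  run (k (compareℤ (weight w (lookup F i)) (weight w (lookup F j)))) w

cost : ∀ {n} {F : List (Subset n)} → Tree F → (Fin n → ℤ) → ℕ
cost (leaf out)    w = 0
cost {F = F} (query i j k) w =
  suc (cost (k (compareℤ (weight w (lookup F i)) (weight w (lookup F j)))) w)

-- Sets are inserted one at a time into a list of equal-weight classes kept sorted by weight, by binary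
-- search over the classes, which costs at most 1 + ⌊log₂ C⌋ queries.  Every equality w(S) = w(R) found this
-- way gives a vector χ S − χ R orthogonal to w; these are kept as an integer echelon system.  Before searching,
-- χ S − χ R is reduced against the system for every representative R: if some reduction vanishes, w(S) = w(R)
-- is known without a query.  So each binary search either creates a new class (at most C times) or adds a
-- vector with a fresh pivot to the system (at most n times), and the potential "rank + number of classes − 1"
-- pays for all searches.  When every |w e| ≤ B, all weights lie in [−nB, nB], so C ≤ 2nB + 1.

module Submission where

open import Data.Bool using (true; false; if_then_else_)
open import Data.Empty using (⊥-elim)
open import Data.Fin using (Fin) renaming (zero to fzero; suc to fsuc)
open import Data.Fin.Properties using (all?; ¬∀⟶∃¬)
open import Data.Fin.Subset using (Subset)
open import Data.Integer as ℤ using (ℤ; 0ℤ; 1ℤ)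
import Data.Integer.Properties as ℤ
open import Data.List
  using (List; []; _∷_; _++_; [_]; length; map; concatMap; lookup; allFin; tabulate; deduplicate; upTo)
open import Data.List.Properties
  using (length-++; length-map; length-tabulate; length-upTo; length-removeAt′; ++-identityʳ; concatMap-++;
         map-tabulate; tabulate-lookup)
open import Data.List.Membership.Propositional using (_∈_)
open import Data.List.Membership.Propositional.Properties
  using (∈-allFin; ∈-lookup; ∈-map⁺; ∈-map⁻; ∈-++⁺ˡ; ∈-++⁺ʳ; ∈-upTo⁺; ∈-deduplicate⁺; ∈-deduplicate⁻)
open import Data.List.Relation.Binary.Permutation.Propositional using (_↭_; ↭-refl; ↭-trans; swap)
import Data.List.Relation.Binary.Permutation.Propositional.Properties as ↭
open import Data.List.Relation.Binary.Subset.Propositional using (_⊆_)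
open import Data.List.Relation.Unary.All as All using (All; []; _∷_)
import Data.List.Relation.Unary.All.Properties as All
open import Data.List.Relation.Unary.AllPairs as AllPairs using (AllPairs; []; _∷_)
import Data.List.Relation.Unary.AllPairs.Properties as AllPairs
open import Data.List.Relation.Unary.Any as Any using (Any; here; there; index; _─_; any?)
open import Data.List.Relation.Unary.Linked using (Linked)
open import Data.List.Relation.Unary.Linked.Properties using (AllPairs⇒Linked)
open import Data.List.Relation.Unary.Unique.Propositional using (Unique)
open import Data.List.Relation.Unary.Unique.DecPropositional.Properties using (deduplicate-!)
open import Data.Maybe using (Maybe; just; nothing)
open import Data.Nat as ℕ using (ℕ; zero; suc; z≤n; s≤s; ⌊_/2⌋; ⌈_/2⌉)
open import Data.Nat.Logarithm using (⌊log₂_⌋; ⌊log₂⌋-mono-≤; ⌊log₂⌊n/2⌋⌋≡⌊log₂n⌋∸1; ⌊log₂[2*b]⌋≡1+⌊log₂b⌋)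
import Data.Nat.Properties as ℕ
import Data.Nat.Solver as ℕ-Solver
open import Data.Product using (Σ; _×_; _,_; proj₁; proj₂)
open import Data.Sum using (inj₁; inj₂)
open import Data.Unit using (⊤)
open import Data.Vec as Vec using ([]; _∷_)
open import Data.Vec.Functional using (Vector; head; tail; foldr; zipWith)
open import Function using (_∘_; case_of_)
open import Level using (Lift)
open import Relation.Binary.Definitions using (tri<; tri≈; tri>)
open import Relation.Binary.PropositionalEquality hiding ([_])
open import Relation.Nullary using (¬_; Dec; yes; no)

open import Defs

private variable
  A : Set
  n : ℕ

∈-─ : {x y : A} {ys : List A} (p : x ∈ ys) → y ∈ ys → y ≢ x → y ∈ (ys ─ p)
∈-─ (here refl) (here refl) y≢x = ⊥-elim (y≢x refl)
∈-─ (here refl) (there q)   y≢x = q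
∈-─ (there p)   (here refl) y≢x = here refl
∈-─ (there p)   (there q)   y≢x = there (∈-─ p q y≢x)

Unique-⊆⇒length≤ : {xs ys : List A} → Unique xs → xs ⊆ ys → length xs ℕ.≤ length ys
Unique-⊆⇒length≤ {xs = []}     _           _    = z≤n
Unique-⊆⇒length≤ {xs = x ∷ xs} {ys} (x∉xs ∷ xs!) xs⊆ys =
  ℕ.≤-trans (s≤s (Unique-⊆⇒length≤ xs! tail⊆)) (ℕ.≤-reflexive (sym (length-removeAt′ ys (index x∈ys))))
  where
  x∈ys = xs⊆ys (here refl)
  tail⊆ : xs ⊆ (ys ─ x∈ys)
  tail⊆ y∈xs = ∈-─ x∈ys (xs⊆ys (there y∈xs)) (λ y≡x → All.lookup x∉xs y∈xs (sym y≡x))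

AllPairs-++⁻ : ∀ {R : A → A → Set} xs {ys} → AllPairs R (xs ++ ys) →
               AllPairs R xs × AllPairs R ys × All (λ x → All (R x) ys) xs
AllPairs-++⁻ []       Rys          = [] , Rys , []
AllPairs-++⁻ (x ∷ xs) (Rxxs ∷ Rxs) =
  let Rxs′ , Rys , Rxsys = AllPairs-++⁻ xs Rxs
  in All.++⁻ˡ xs Rxxs ∷ Rxs′ , Rys , All.++⁻ʳ xs Rxxs ∷ Rxsys

IsZero : Vector ℤ n → Set
IsZero v = ∀ k → v k ≡ 0ℤ

isZero? : (v : Vector ℤ n) → Dec (IsZero v)
isZero? v = all? (λ k → v k ℤ.≟ 0ℤ)

nonzeroEntry : {v : Vector ℤ n} → ¬ IsZero v → Σ (Fin n) λ k → v k ≢ 0ℤ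
nonzeroEntry {v = v} = ¬∀⟶∃¬ _ (λ k → v k ≡ 0ℤ) (λ k → v k ℤ.≟ 0ℤ)

module _ where
  open import Data.Integer using (_+_; _*_; _-_)
  open import Data.Integer.Solver using (module +-*-Solver)
  open +-*-Solver

  _∙_ : Vector ℤ n → Vector ℤ n → ℤ
  w ∙ v = foldr _+_ 0ℤ (zipWith _*_ w v)

  χ : Subset n → Vector ℤ n
  χ S k = if Vec.lookup S k then 1ℤ else 0ℤ

  weight≡∙χ : (w : Vector ℤ n) (S : Subset n) → weight w S ≡ w ∙ χ S
  weight≡∙χ w []          = refl
  weight≡∙χ w (true ∷ S)  = cong₂ _+_ (sym (ℤ.*-identityʳ (head w))) (weight≡∙χ (tail w) S)
  weight≡∙χ w (false ∷ S) = cong₂ _+_ (sym (ℤ.*-zeroʳ (head w))) (weight≡∙χ (tail w) S)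

  lincomb : ℤ → Vector ℤ n → ℤ → Vector ℤ n → Vector ℤ n
  lincomb a u c v k = a * u k - c * v k

  ∙-lincomb : ∀ (w : Vector ℤ n) a u c v → w ∙ lincomb a u c v ≡ a * (w ∙ u) - c * (w ∙ v)
  ∙-lincomb {zero}  w a u c v = sym (cong₂ _-_ (ℤ.*-zeroʳ a) (ℤ.*-zeroʳ c))
  ∙-lincomb {suc n} w a u c v = begin
    head w * (a * head u - c * head v) + tail w ∙ lincomb a (tail u) c (tail v)
      ≡⟨ cong (head w * (a * head u - c * head v) +_) (∙-lincomb (tail w) a (tail u) c (tail v)) ⟩
    head w * (a * head u - c * head v) + (a * (tail w ∙ tail u) - c * (tail w ∙ tail v))
      ≡⟨ solve 7 (λ w₀ a u₀ c v₀ U V → w₀ :* (a :* u₀ :- c :* v₀) :+ (a :* U :- c :* V)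
                                     := a :* (w₀ :* u₀ :+ U) :- c :* (w₀ :* v₀ :+ V))
               refl (head w) a (head u) c (head v) (tail w ∙ tail u) (tail w ∙ tail v) ⟩
    a * (w ∙ u) - c * (w ∙ v) ∎
    where open ≡-Reasoning

  ∙-zeroʳ : (w v : Vector ℤ n) → IsZero v → w ∙ v ≡ 0ℤ
  ∙-zeroʳ {zero}  w v v≡0 = refl
  ∙-zeroʳ {suc n} w v v≡0
    rewrite v≡0 fzero | ∙-zeroʳ (tail w) (tail v) (v≡0 ∘ fsuc) = trans (ℤ.+-identityʳ _) (ℤ.*-zeroʳ (head w))

record Pivoted (n : ℕ) : Set where
  constructor _at_
  field
    vector : Vector ℤ n
    pivot  : Fin n
open Pivoted

module _ where
  open import Data.Integer using (_*_; _-_)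

  eliminate : Pivoted n → Vector ℤ n → Vector ℤ n
  eliminate (b at p) v = lincomb (b p) v (v p) b

  reduce : List (Pivoted n) → Vector ℤ n → Vector ℤ n
  reduce []       v = v
  reduce (e ∷ es) v = reduce es (eliminate e v)

  eliminate-pivot : ∀ (e : Pivoted n) v → eliminate e v (pivot e) ≡ 0ℤ
  eliminate-pivot (b at p) v = ℤ.i≡j⇒i-j≡0 (ℤ.*-comm (b p) (v p))

  eliminate-zero : ∀ (e : Pivoted n) v q → v q ≡ 0ℤ → vector e q ≡ 0ℤ → eliminate e v q ≡ 0ℤ
  eliminate-zero (b at p) v q vq≡0 bq≡0
    rewrite vq≡0 | bq≡0 | ℤ.*-zeroʳ (b p) | ℤ.*-zeroʳ (v p) = refl

  reduce-zero : ∀ (es : List (Pivoted n)) v q →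
                v q ≡ 0ℤ → All (λ e → vector e q ≡ 0ℤ) es → reduce es v q ≡ 0ℤ
  reduce-zero []       v q vq≡0 []           = vq≡0
  reduce-zero (e ∷ es) v q vq≡0 (eq≡0 ∷ esq≡0) =
    reduce-zero es (eliminate e v) q (eliminate-zero e v q vq≡0 eq≡0) esq≡0

  VanishesAtPivotOf : Pivoted n → Pivoted n → Set
  VanishesAtPivotOf e e′ = vector e′ (pivot e) ≡ 0ℤ

  reduce-zero-at-pivots : ∀ {es : List (Pivoted n)} v → AllPairs VanishesAtPivotOf es →
                          All (λ e → reduce es v (pivot e) ≡ 0ℤ) es
  reduce-zero-at-pivots v [] = []
  reduce-zero-at-pivots {es = e ∷ es} v (later≡0 ∷ es-ech) =
    reduce-zero es (eliminate e v) (pivot e) (eliminate-pivot e v) later≡0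
    ∷ reduce-zero-at-pivots (eliminate e v) es-ech

  NonzeroPivot : Pivoted n → Set
  NonzeroPivot e = vector e (pivot e) ≢ 0ℤ

  Orthogonal : Vector ℤ n → Pivoted n → Set
  Orthogonal w e = w ∙ vector e ≡ 0ℤ

  ∙-eliminate : ∀ w (e : Pivoted n) v → Orthogonal w e → w ∙ eliminate e v ≡ vector e (pivot e) * (w ∙ v)
  ∙-eliminate w (b at p) v w∙b≡0 = begin
    w ∙ lincomb (b p) v (v p) b   ≡⟨ ∙-lincomb w (b p) v (v p) b ⟩
    b p * (w ∙ v) - v p * (w ∙ b) ≡⟨ cong (λ t → b p * (w ∙ v) - v p * t) w∙b≡0 ⟩
    b p * (w ∙ v) - v p * 0ℤ      ≡⟨ cong (λ t → b p * (w ∙ v) - t) (ℤ.*-zeroʳ (v p)) ⟩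
    b p * (w ∙ v) - 0ℤ            ≡⟨ ℤ.+-identityʳ _ ⟩
    b p * (w ∙ v)                 ∎
    where open ≡-Reasoning

  reduce-orthogonal : ∀ w (es : List (Pivoted n)) v →
                      All (Orthogonal w) es → w ∙ v ≡ 0ℤ → w ∙ reduce es v ≡ 0ℤ
  reduce-orthogonal w []       v []           w∙v≡0 = w∙v≡0
  reduce-orthogonal w (e ∷ es) v (w⊥e ∷ w⊥es) w∙v≡0 =
    reduce-orthogonal w es (eliminate e v) w⊥es
      (begin
        w ∙ eliminate e v              ≡⟨ ∙-eliminate w e v w⊥e ⟩
        vector e (pivot e) * (w ∙ v)   ≡⟨ cong (vector e (pivot e) *_) w∙v≡0 ⟩
        vector e (pivot e) * 0ℤ        ≡⟨ ℤ.*-zeroʳ (vector e (pivot e)) ⟩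
        0ℤ                             ∎)
    where open ≡-Reasoning

  reduce-orthogonal⁻ : ∀ w (es : List (Pivoted n)) v → All (Orthogonal w) es →
                       All NonzeroPivot es → w ∙ reduce es v ≡ 0ℤ → w ∙ v ≡ 0ℤ
  reduce-orthogonal⁻ w []       v []           []               w∙v≡0 = w∙v≡0
  reduce-orthogonal⁻ w (e ∷ es) v (w⊥e ∷ w⊥es) (pivot≢0 ∷ pivots≢0) w∙r≡0
    with ℤ.i*j≡0⇒i≡0∨j≡0 (vector e (pivot e))
           (trans (sym (∙-eliminate w e v w⊥e)) (reduce-orthogonal⁻ w es (eliminate e v) w⊥es pivots≢0 w∙r≡0))
  ... | inj₁ pivot≡0 = ⊥-elim (pivot≢0 pivot≡0)
  ... | inj₂ w∙v≡0   = w∙v≡0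

Echelon : List (Pivoted n) → Set
Echelon es = AllPairs VanishesAtPivotOf es × All NonzeroPivot es

pivots-unique : {es : List (Pivoted n)} → Echelon es → Unique (map pivot es)
pivots-unique ([] , []) = []
pivots-unique {es = e ∷ es} (later≡0 ∷ ech , _ ∷ es≢0) =
  All.map⁺ (All.zipWith distinct (later≡0 , es≢0)) ∷ pivots-unique (ech , es≢0)
  where
  distinct : ∀ {e′} → VanishesAtPivotOf e e′ × NonzeroPivot e′ → pivot e ≢ pivot e′
  distinct {e′} (e′≡0 , e′≢0) p≡p′ = e′≢0 (subst (λ k → vector e′ k ≡ 0ℤ) p≡p′ e′≡0)

echelon-length≤ : {es : List (Pivoted n)} → Echelon es → length es ℕ.≤ n
echelon-length≤ {n = n} {es} ech = begin
  length es             ≡⟨ length-map pivot es ⟨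
  length (map pivot es) ≤⟨ Unique-⊆⇒length≤ (pivots-unique ech) (λ {k} _ → ∈-allFin k) ⟩
  length (allFin n)     ≡⟨ length-tabulate (λ k → k) ⟩
  n                     ∎
  where open ℕ.≤-Reasoning

extend : List (Pivoted n) → Vector ℤ n → List (Pivoted n)
extend es v with isZero? (reduce es v)
... | yes _   = es
... | no r≢0 = es ++ [ reduce es v at proj₁ (nonzeroEntry r≢0) ]

extend-echelon : ∀ {es : List (Pivoted n)} v → Echelon es → Echelon (extend es v)
extend-echelon {es = es} v (ech , es≢0) with isZero? (reduce es v)
... | yes _   = ech , es≢0
... | no r≢0 =
  AllPairs.++⁺ ech ([] ∷ []) (All.map (_∷ []) (reduce-zero-at-pivots v ech)) ,
  All.++⁺ es≢0 (proj₂ (nonzeroEntry r≢0) ∷ [])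

extend-orthogonal : ∀ w {es : List (Pivoted n)} v →
                    All (Orthogonal w) es → w ∙ v ≡ 0ℤ → All (Orthogonal w) (extend es v)
extend-orthogonal w {es} v w⊥es w∙v≡0 with isZero? (reduce es v)
... | yes _ = w⊥es
... | no _  = All.++⁺ w⊥es (reduce-orthogonal w es v w⊥es w∙v≡0 ∷ [])

extend-length : ∀ (es : List (Pivoted n)) v → ¬ IsZero (reduce es v) → length (extend es v) ≡ suc (length es)
extend-length es v r≢0 with isZero? (reduce es v)
... | yes r≡0 = ⊥-elim (r≢0 r≡0)
... | no _    = trans (length-++ es) (ℕ.+-comm (length es) 1)

data CompareView (x y : ℤ) : Outcome → Set where
  less    : x ℤ.< y → CompareView x y lt
  equal   : x ≡ y   → CompareView x y eq
  greater : y ℤ.< x → CompareView x y gt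

compare-view : ∀ x y → CompareView x y (compareℤ x y)
compare-view x y with ℤ.<-cmp x y
... | tri< x<y _ _ = less x<y
... | tri≈ _ x≡y _ = equal x≡y
... | tri> _ _ y<x = greater y<x

open import Data.Nat using (_+_; _*_; _∸_)

record Split (A : Set) : Set where
  constructor _‹_›_
  field
    left   : List A
    middle : A
    right  : List A

unsplit : Split A → List A
unsplit (ls ‹ m › rs) = ls ++ m ∷ rs

splitAt′ : ℕ → A → List A → Split A
splitAt′ zero    x xs       = [] ‹ x › xs
splitAt′ (suc h) x []       = [] ‹ x › []
splitAt′ (suc h) x (y ∷ ys) = let ls ‹ m › rs = splitAt′ h y ys in (x ∷ ls) ‹ m › rs

unsplit-splitAt′ : ∀ h (x : A) xs → unsplit (splitAt′ h x xs) ≡ x ∷ xs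
unsplit-splitAt′ zero    x xs       = refl
unsplit-splitAt′ (suc h) x []       = refl
unsplit-splitAt′ (suc h) x (y ∷ ys) = cong (x ∷_) (unsplit-splitAt′ h y ys)

length-left-splitAt′ : ∀ h (x : A) xs → length (Split.left (splitAt′ h x xs)) ℕ.≤ h
length-left-splitAt′ zero    x xs       = z≤n
length-left-splitAt′ (suc h) x []       = z≤n
length-left-splitAt′ (suc h) x (y ∷ ys) = s≤s (length-left-splitAt′ h y ys)

length-right-splitAt′ : ∀ h (x : A) xs → length (Split.right (splitAt′ h x xs)) ℕ.≤ length xs ∸ h
length-right-splitAt′ zero    x xs       = ℕ.≤-refl
length-right-splitAt′ (suc h) x []       = z≤n
length-right-splitAt′ (suc h) x (y ∷ ys) = length-right-splitAt′ h y ys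

halve : A → List A → Split A
halve x xs = splitAt′ ⌊ suc (length xs) /2⌋ x xs

unsplit-halve : ∀ (x : A) xs → unsplit (halve x xs) ≡ x ∷ xs
unsplit-halve x xs = unsplit-splitAt′ ⌊ suc (length xs) /2⌋ x xs

halve-left-≤ : ∀ (x : A) xs → length (Split.left (halve x xs)) ℕ.≤ ⌊ suc (length xs) /2⌋
halve-left-≤ x xs = length-left-splitAt′ ⌊ suc (length xs) /2⌋ x xs

halve-right-≤ : ∀ (x : A) xs → length (Split.right (halve x xs)) ℕ.≤ ⌊ suc (length xs) /2⌋
halve-right-≤ x xs = begin
  length (Split.right (halve x xs)) ≤⟨ length-right-splitAt′ ⌈ L /2⌉ x xs ⟩
  L ∸ ⌈ L /2⌉                       ≡⟨ cong (_∸ ⌈ L /2⌉) (ℕ.⌊n/2⌋+⌈n/2⌉≡n L) ⟨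
  ⌊ L /2⌋ + ⌈ L /2⌉ ∸ ⌈ L /2⌉       ≡⟨ ℕ.m+n∸n≡m ⌊ L /2⌋ ⌈ L /2⌉ ⟩
  ⌊ L /2⌋                           ≤⟨ ℕ.⌊n/2⌋≤⌈n/2⌉ L ⟩
  ⌈ L /2⌉                           ∎
  where
  open ℕ.≤-Reasoning
  L = length xs

searchDepth : ℕ → ℕ
searchDepth zero    = 0
searchDepth (suc L) = suc ⌊log₂ suc L ⌋

searchDepth-mono-≤ : ∀ {k l} → k ℕ.≤ l → searchDepth k ℕ.≤ searchDepth l
searchDepth-mono-≤ z≤n       = z≤n
searchDepth-mono-≤ (s≤s k≤l) = s≤s (⌊log₂⌋-mono-≤ (s≤s k≤l))

searchDepth-halve : ∀ L j → j ℕ.≤ ⌊ suc L /2⌋ → searchDepth j ℕ.< searchDepth (suc L)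
searchDepth-halve L       zero    _  = s≤s z≤n
searchDepth-halve zero    (suc j) ()
searchDepth-halve (suc L) (suc j) j≤ = s≤s (begin
  suc ⌊log₂ suc j ⌋                 ≤⟨ s≤s (⌊log₂⌋-mono-≤ j≤) ⟩
  suc ⌊log₂ ⌊ 2 + L /2⌋ ⌋           ≡⟨ cong suc (⌊log₂⌊n/2⌋⌋≡⌊log₂n⌋∸1 (2 + L)) ⟩
  1 + (⌊log₂ (2 + L) ⌋ ∸ 1)         ≡⟨ ℕ.m+[n∸m]≡n (⌊log₂⌋-mono-≤ {2} {2 + L} (s≤s (s≤s z≤n))) ⟩
  ⌊log₂ (2 + L) ⌋                   ∎)
  where open ℕ.≤-Reasoning

distinctWeights : List (Subset n) → Vector ℤ n → ℕ
distinctWeights F w = length (deduplicate ℤ._≟_ (map (weight w) F))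

module Algorithm {n : ℕ} (F : List (Subset n)) where

  Idx : Set
  Idx = Fin (length F)

  set : Idx → Subset n
  set = lookup F

  data Query (A : Set) : Set where
    return : A → Query A
    ask    : Idx → Idx → (Outcome → Query A) → Query A

  _>>=_ : {A B : Set} → Query A → (A → Query B) → Query B
  return a  >>= k = k a
  ask i j f >>= k = ask i j (λ o → f o >>= k)

  toTree : Query (List (Subset n)) → Tree F
  toTree (return out) = leaf out
  toTree (ask i j f)  = query i j (λ o → toTree (f o))

  record Class : Set where
    constructor _◂_
    field
      rep    : Idx
      others : List Idx
  open Class public

  members : Class → List Idx
  members c = rep c ∷ others c

  flatten : List Class → List Idx
  flatten = concatMap members

  join : Idx → Class → Class
  join i (r ◂ rs) = r ◂ (i ∷ rs)

  -- The Maybe is the representative of the class that i joined, if any.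
  mutual
    binaryInsert : ℕ → Idx → List Class → Query (List Class × Maybe Idx)
    binaryInsert _       i []       = return ((i ◂ []) ∷ [] , nothing)
    binaryInsert zero    i (c ∷ cs) = return ((i ◂ []) ∷ c ∷ cs , nothing)   -- unreachable: fuel ≥ length
    binaryInsert (suc f) i (c ∷ cs) = insertAround f i (halve c cs)

    insertAround : ℕ → Idx → Split Class → Query (List Class × Maybe Idx)
    insertAround f i (ls ‹ m › rs) = ask i (rep m) λ where
      lt → binaryInsert f i ls >>= λ (ls′ , r) → return (ls′ ++ m ∷ rs , r)
      eq → return (ls ++ join i m ∷ rs , just (rep m))
      gt → binaryInsert f i rs >>= λ (rs′ , r) → return (ls ++ m ∷ rs′ , r)

  joinAt : {P : Class → Set} → Idx → (cs : List Class) → Any P cs → List Class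
  joinAt i (c ∷ cs) (here _)  = join i c ∷ cs
  joinAt i (c ∷ cs) (there p) = c ∷ joinAt i cs p

  difference : Idx → Idx → Vector ℤ n
  difference i j = lincomb 1ℤ (χ (set i)) 1ℤ (χ (set j))

  State : Set
  State = List (Pivoted n) × List Class

  newBasis : List (Pivoted n) → Idx → Maybe Idx → List (Pivoted n)
  newBasis es i nothing  = es
  newBasis es i (just r) = extend es (difference i r)

  insert : Idx → State → Query State
  insert i (es , cs) with any? (λ c → isZero? (reduce es (difference i (rep c)))) cs
  ... | yes p = return (es , joinAt i cs p)
  ... | no _  = binaryInsert (length cs) i cs >>= λ (cs′ , r) → return (newBasis es i r , cs′)

  insertAll : List Idx → State → Query State
  insertAll []       s = return s
  insertAll (i ∷ is) s = insert i s >>= insertAll is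

  classify : Query State
  classify = insertAll (allFin (length F)) ([] , [])

  sortFamily : Query (List (Subset n))
  sortFamily = classify >>= λ (_ , cs) → return (map set (flatten cs))

module Analysis {n : ℕ} (F : List (Subset n)) (w : Vector ℤ n) where
  open Algorithm F

  wt : Idx → ℤ
  wt i = weight w (set i)

  answer : Idx → Idx → Outcome
  answer i j = compareℤ (wt i) (wt j)

  eval : {A : Set} → Query A → A
  eval (return a)  = a
  eval (ask i j k) = eval (k (answer i j))

  queries : {A : Set} → Query A → ℕ
  queries (return a)  = 0
  queries (ask i j k) = suc (queries (k (answer i j)))

  eval->>= : {A B : Set} (m : Query A) (k : A → Query B) → eval (m >>= k) ≡ eval (k (eval m))
  eval->>= (return a)  k = refl
  eval->>= (ask i j f) k = eval->>= (f (answer i j)) k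

  queries->>= : {A B : Set} (m : Query A) (k : A → Query B) →
                queries (m >>= k) ≡ queries m + queries (k (eval m))
  queries->>= (return a)  k = refl
  queries->>= (ask i j f) k = cong suc (queries->>= (f (answer i j)) k)

  queries-map : {A B : Set} (m : Query A) (k : A → B) → queries (m >>= (return ∘ k)) ≡ queries m
  queries-map (return a)  k = refl
  queries-map (ask i j f) k = cong suc (queries-map (f (answer i j)) k)

  run-toTree : (m : Query (List (Subset n))) → run (toTree m) w ≡ eval m
  run-toTree (return out) = refl
  run-toTree (ask i j f)  = run-toTree (f (answer i j))

  cost-toTree : (m : Query (List (Subset n))) → cost (toTree m) w ≡ queries m
  cost-toTree (return out) = refl
  cost-toTree (ask i j f)  = cong suc (cost-toTree (f (answer i j)))

  _≺_ : Class → Class → Set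
  c ≺ d = wt (rep c) ℤ.< wt (rep d)

  Sorted : List Class → Set
  Sorted = AllPairs _≺_

  Homogeneous : Class → Set
  Homogeneous c = All (λ j → wt j ≡ wt (rep c)) (others c)

  -- Membership and inclusion among representatives, stated by their closure properties.
  _∈Reps_ : Idx → List Class → Set₁
  r ∈Reps cs = ∀ (P : Idx → Set) → All (P ∘ rep) cs → P r

  RepsWithin : Idx → List Class → List Class → Set₁
  RepsWithin i cs cs′ = ∀ (P : Idx → Set) → All (P ∘ rep) cs → P i → All (P ∘ rep) cs′

  Joined : Idx → List Class → Maybe Idx → Set₁
  Joined i cs nothing  = Lift _ ⊤
  Joined i cs (just r) = wt i ≡ wt r × r ∈Reps cs

  Joined-anti : ∀ {i cs cs′} r → (∀ {P : Class → Set} → All P cs′ → All P cs) → Joined i cs r → Joined i cs′ r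
  Joined-anti nothing  _      _            = _
  Joined-anti (just r) cs⊆cs′ (i≈r , r∈cs) = i≈r , λ P Pcs′ → r∈cs P (cs⊆cs′ Pcs′)

  newClasses : Maybe Idx → ℕ
  newClasses nothing  = 1
  newClasses (just _) = 0

  record Inserted (i : Idx) (cs : List Class) (result : List Class × Maybe Idx) : Set₁ where
    field
      permutation : flatten (proj₁ result) ↭ i ∷ flatten cs
      sorted      : Sorted (proj₁ result)
      homogeneous : All Homogeneous (proj₁ result)
      reps        : RepsWithin i cs (proj₁ result)
      grows       : length (proj₁ result) ≡ newClasses (proj₂ result) + length cs
      joined      : Joined i cs (proj₂ result)

  inserted-left : ∀ {i} ls m rs (res : List Class × Maybe Idx) → wt i ℤ.< wt (rep m) →
                  Sorted (ls ++ m ∷ rs) → All Homogeneous (ls ++ m ∷ rs) →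
                  Inserted i ls res → Inserted i (ls ++ m ∷ rs) (proj₁ res ++ m ∷ rs , proj₂ res)
  inserted-left {i} ls m rs (ls′ , r) i<m sorted homogeneous ins with AllPairs-++⁻ ls sorted
  ... | _ , m≺rs ∷ sorted-rs , ls≺mrs = record
    { permutation = permutation
    ; sorted      = AllPairs.++⁺ I.sorted (m≺rs ∷ sorted-rs)
                      (I.reps (λ j → All (λ d → wt j ℤ.< wt (rep d)) (m ∷ rs)) ls≺mrs i≺mrs)
    ; homogeneous = All.++⁺ I.homogeneous (All.++⁻ʳ ls homogeneous)
    ; reps        = λ P Pcs Pi → All.++⁺ (I.reps P (All.++⁻ˡ ls Pcs) Pi) (All.++⁻ʳ ls Pcs)
    ; grows       = grows
    ; joined      = Joined-anti r (All.++⁻ˡ ls) I.joined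
    }
    where
    module I = Inserted ins
    k = newClasses r

    i≺mrs : All (λ d → wt i ℤ.< wt (rep d)) (m ∷ rs)
    i≺mrs = i<m ∷ All.map (ℤ.<-trans i<m) m≺rs

    permutation : flatten (ls′ ++ m ∷ rs) ↭ i ∷ flatten (ls ++ m ∷ rs)
    permutation rewrite concatMap-++ members ls′ (m ∷ rs) | concatMap-++ members ls (m ∷ rs) =
      ↭.++⁺ʳ (flatten (m ∷ rs)) I.permutation

    grows : length (ls′ ++ m ∷ rs) ≡ k + length (ls ++ m ∷ rs)
    grows = begin
      length (ls′ ++ m ∷ rs)              ≡⟨ length-++ ls′ ⟩
      length ls′ + length (m ∷ rs)        ≡⟨ cong (_+ length (m ∷ rs)) I.grows ⟩
      k + length ls + length (m ∷ rs)     ≡⟨ ℕ.+-assoc k (length ls) _ ⟩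
      k + (length ls + length (m ∷ rs))   ≡⟨ cong (k +_) (length-++ ls) ⟨
      k + length (ls ++ m ∷ rs)           ∎
      where open ≡-Reasoning

  inserted-right : ∀ {i} ls m rs (res : List Class × Maybe Idx) → wt (rep m) ℤ.< wt i →
                   Sorted (ls ++ m ∷ rs) → All Homogeneous (ls ++ m ∷ rs) →
                   Inserted i rs res → Inserted i (ls ++ m ∷ rs) (ls ++ m ∷ proj₁ res , proj₂ res)
  inserted-right {i} ls m rs (rs′ , r) m<i sorted homogeneous ins
    with AllPairs-++⁻ ls sorted | All.++⁻ ls homogeneous
  ... | sorted-ls , m≺rs ∷ _ , ls≺mrs | homogeneous-ls , homogeneous-m ∷ _ = record
    { permutation = permutation
    ; sorted      = AllPairs.++⁺ sorted-ls (I.reps (λ j → wt (rep m) ℤ.< wt j) m≺rs m<i ∷ I.sorted)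
                      (All.map (λ {c} → below-m∷rs′ {c}) ls≺mrs)
    ; homogeneous = All.++⁺ homogeneous-ls (homogeneous-m ∷ I.homogeneous)
    ; reps        = λ P Pcs Pi → All.++⁺ (All.++⁻ˡ ls Pcs)
                                         (case All.++⁻ʳ ls Pcs of λ { (Pm ∷ Prs) → Pm ∷ I.reps P Prs Pi })
    ; grows       = grows
    ; joined      = Joined-anti r (All.tail ∘ All.++⁻ʳ ls) I.joined
    }
    where
    module I = Inserted ins
    k = newClasses r

    permutation : flatten (ls ++ m ∷ rs′) ↭ i ∷ flatten (ls ++ m ∷ rs)
    permutation rewrite concatMap-++ members ls (m ∷ rs′) | concatMap-++ members ls (m ∷ rs) =
      ↭-trans (↭.++⁺ˡ (flatten ls)
                 (↭-trans (↭.++⁺ˡ (members m) I.permutation) (↭.shift i (members m) (flatten rs))))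
              (↭.shift i (flatten ls) (flatten (m ∷ rs)))

    below-m∷rs′ : ∀ {c} → All (c ≺_) (m ∷ rs) → All (c ≺_) (m ∷ rs′)
    below-m∷rs′ {c} (c≺m ∷ c≺rs) = c≺m ∷ I.reps (λ j → wt (rep c) ℤ.< wt j) c≺rs (ℤ.<-trans c≺m m<i)

    grows : length (ls ++ m ∷ rs′) ≡ k + length (ls ++ m ∷ rs)
    grows = begin
      length (ls ++ m ∷ rs′)              ≡⟨ length-++ ls ⟩
      length ls + suc (length rs′)        ≡⟨ cong (λ t → length ls + suc t) I.grows ⟩
      length ls + suc (k + length rs)     ≡⟨ cong (length ls +_) (ℕ.+-suc k (length rs)) ⟨
      length ls + (k + length (m ∷ rs))   ≡⟨ ℕ.+-assoc (length ls) k _ ⟨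
      length ls + k + length (m ∷ rs)     ≡⟨ cong (_+ length (m ∷ rs)) (ℕ.+-comm (length ls) k) ⟩
      k + length ls + length (m ∷ rs)     ≡⟨ ℕ.+-assoc k (length ls) _ ⟩
      k + (length ls + length (m ∷ rs))   ≡⟨ cong (k +_) (length-++ ls) ⟨
      k + length (ls ++ m ∷ rs)           ∎
      where open ≡-Reasoning

  inserted-here : ∀ {i} ls m rs → wt i ≡ wt (rep m) → Sorted (ls ++ m ∷ rs) → All Homogeneous (ls ++ m ∷ rs) →
                  Inserted i (ls ++ m ∷ rs) (ls ++ join i m ∷ rs , just (rep m))
  inserted-here {i} ls m rs i≈m sorted homogeneous
    with AllPairs-++⁻ ls sorted | All.++⁻ ls homogeneous
  ... | sorted-ls , m≺rs ∷ sorted-rs , ls≺mrs | homogeneous-ls , homogeneous-m ∷ homogeneous-rs = record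
    { permutation = permutation
    ; sorted      = AllPairs.++⁺ sorted-ls (m≺rs ∷ sorted-rs)
                      (All.map (λ { (c≺m ∷ c≺rs) → c≺m ∷ c≺rs }) ls≺mrs)
    ; homogeneous = All.++⁺ homogeneous-ls ((i≈m ∷ homogeneous-m) ∷ homogeneous-rs)
    ; reps        = λ P Pcs _ → All.++⁺ (All.++⁻ˡ ls Pcs)
                                        (case All.++⁻ʳ ls Pcs of λ { (Pm ∷ Prs) → Pm ∷ Prs })
    ; grows       = trans (length-++ ls) (sym (length-++ ls))
    ; joined      = i≈m , λ P Pcs → All.head (All.++⁻ʳ ls Pcs)
    }
    where
    permutation : flatten (ls ++ join i m ∷ rs) ↭ i ∷ flatten (ls ++ m ∷ rs)
    permutation rewrite concatMap-++ members ls (join i m ∷ rs) | concatMap-++ members ls (m ∷ rs) =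
      ↭-trans (↭.++⁺ˡ (flatten ls) (swap (rep m) i ↭-refl)) (↭.shift i (flatten ls) _)

  mutual
    binaryInsert-correct : ∀ f i cs → length cs ℕ.≤ f → Sorted cs → All Homogeneous cs →
                           Inserted i cs (eval (binaryInsert f i cs))
    binaryInsert-correct _ i [] _ _ _ = record
      { permutation = ↭-refl ; sorted = [] ∷ [] ; homogeneous = [] ∷ []
      ; reps = λ P _ Pi → Pi ∷ [] ; grows = refl ; joined = _ }
    binaryInsert-correct (suc f) i (c ∷ cs) (s≤s L≤f) sorted homogeneous =
      subst (λ cs′ → Inserted i cs′ (eval (insertAround f i (halve c cs)))) (unsplit-halve c cs)
        (insertAround-correct f i (halve c cs) (fits (halve-left-≤ c cs)) (fits (halve-right-≤ c cs))
          (subst Sorted (sym (unsplit-halve c cs)) sorted)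
          (subst (All Homogeneous) (sym (unsplit-halve c cs)) homogeneous))
      where
      fits : ∀ {k} → k ℕ.≤ ⌊ suc (length cs) /2⌋ → k ℕ.≤ f
      fits k≤ = ℕ.≤-trans k≤ (ℕ.≤-trans (ℕ.⌈n/2⌉≤n (length cs)) L≤f)

    insertAround-correct : ∀ f i s → length (Split.left s) ℕ.≤ f → length (Split.right s) ℕ.≤ f →
                           Sorted (unsplit s) → All Homogeneous (unsplit s) →
                           Inserted i (unsplit s) (eval (insertAround f i s))
    insertAround-correct f i (ls ‹ m › rs) ls≤f rs≤f sorted homogeneous
      with answer i (rep m) | compare-view (wt i) (wt (rep m))
    ... | lt | less i<m =
      subst (Inserted i (ls ++ m ∷ rs)) (sym (eval->>= (binaryInsert f i ls) _))
        (inserted-left ls m rs _ i<m sorted homogeneous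
          (binaryInsert-correct f i ls ls≤f (proj₁ (AllPairs-++⁻ ls sorted)) (All.++⁻ˡ ls homogeneous)))
    ... | eq | equal i≈m = inserted-here ls m rs i≈m sorted homogeneous
    ... | gt | greater m<i =
      subst (Inserted i (ls ++ m ∷ rs)) (sym (eval->>= (binaryInsert f i rs) _))
        (inserted-right ls m rs _ m<i sorted homogeneous
          (binaryInsert-correct f i rs rs≤f (AllPairs.tail (proj₁ (proj₂ (AllPairs-++⁻ ls sorted))))
            (All.tail (All.++⁻ʳ ls homogeneous))))

  mutual
    binaryInsert-queries : ∀ f i cs → length cs ℕ.≤ f → queries (binaryInsert f i cs) ℕ.≤ searchDepth (length cs)
    binaryInsert-queries _       i []       _         = z≤n
    binaryInsert-queries (suc f) i (c ∷ cs) (s≤s L≤f) =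
      insertAround-queries f i (halve c cs) (length cs) (halve-left-≤ c cs) (halve-right-≤ c cs)
        (ℕ.≤-trans (ℕ.⌈n/2⌉≤n (length cs)) L≤f)

    insertAround-queries : ∀ f i s L → length (Split.left s) ℕ.≤ ⌊ suc L /2⌋ →
                           length (Split.right s) ℕ.≤ ⌊ suc L /2⌋ → ⌊ suc L /2⌋ ℕ.≤ f →
                           queries (insertAround f i s) ℕ.≤ searchDepth (suc L)
    insertAround-queries f i (ls ‹ m › rs) L ls≤ rs≤ half≤f with answer i (rep m)
    ... | lt = subst (ℕ._< searchDepth (suc L)) (sym (queries-map (binaryInsert f i ls) _))
                 (binaryInsert-queries-half f i ls L ls≤ half≤f)
    ... | eq = s≤s z≤n
    ... | gt = subst (ℕ._< searchDepth (suc L)) (sym (queries-map (binaryInsert f i rs) _))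
                 (binaryInsert-queries-half f i rs L rs≤ half≤f)

    binaryInsert-queries-half : ∀ f i cs L → length cs ℕ.≤ ⌊ suc L /2⌋ → ⌊ suc L /2⌋ ℕ.≤ f →
                                queries (binaryInsert f i cs) ℕ.< searchDepth (suc L)
    binaryInsert-queries-half f i cs L cs≤ half≤f = ℕ.≤-<-trans
      (binaryInsert-queries f i cs (ℕ.≤-trans cs≤ half≤f)) (searchDepth-halve L (length cs) cs≤)

  joinAt-inserted : ∀ {P : Class → Set} i cs (p : Any P cs) → (∀ {c} → P c → wt i ≡ wt (rep c)) →
                    Sorted cs → All Homogeneous cs → Inserted i cs (joinAt i cs p , just (rep (Any.lookup p)))
  joinAt-inserted i (c ∷ cs) (here Pc) i≈ (c≺cs ∷ sorted) (homogeneous-c ∷ homogeneous) = record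
    { permutation = swap (rep c) i ↭-refl
    ; sorted      = c≺cs ∷ sorted
    ; homogeneous = (i≈ Pc ∷ homogeneous-c) ∷ homogeneous
    ; reps        = λ { P (Pc ∷ Pcs) _ → Pc ∷ Pcs }
    ; grows       = refl
    ; joined      = i≈ Pc , λ P Pcs → All.head Pcs
    }
  joinAt-inserted i (c ∷ cs) (there p) i≈ (c≺cs ∷ sorted) (homogeneous-c ∷ homogeneous) = record
    { permutation = ↭-trans (↭.++⁺ˡ (members c) I.permutation) (↭.shift i (members c) (flatten cs))
    ; sorted      = I.reps (λ j → wt (rep c) ℤ.< wt j) c≺cs c<i ∷ I.sorted
    ; homogeneous = homogeneous-c ∷ I.homogeneous
    ; reps        = λ { P (Pc ∷ Pcs) Pi → Pc ∷ I.reps P Pcs Pi }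
    ; grows       = cong suc I.grows
    ; joined      = Joined-anti (just _) All.tail I.joined
    }
    where
    module I = Inserted (joinAt-inserted i cs p i≈ sorted homogeneous)
    c<i : wt (rep c) ℤ.< wt i
    c<i = let i≈r , r∈cs = I.joined in subst (wt (rep c) ℤ.<_) (sym i≈r) (r∈cs (λ j → wt (rep c) ℤ.< wt j) c≺cs)

  ∙-difference : ∀ i j → w ∙ difference i j ≡ wt i ℤ.- wt j
  ∙-difference i j = begin
    w ∙ difference i j
      ≡⟨ ∙-lincomb w 1ℤ (χ (set i)) 1ℤ (χ (set j)) ⟩
    1ℤ ℤ.* (w ∙ χ (set i)) ℤ.- 1ℤ ℤ.* (w ∙ χ (set j))
      ≡⟨ cong₂ ℤ._-_ (ℤ.*-identityˡ (w ∙ χ (set i))) (ℤ.*-identityˡ (w ∙ χ (set j))) ⟩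
    w ∙ χ (set i) ℤ.- w ∙ χ (set j)
      ≡⟨ cong₂ ℤ._-_ (weight≡∙χ w (set i)) (weight≡∙χ w (set j)) ⟨
    wt i ℤ.- wt j
      ∎
    where open ≡-Reasoning

  BasisInvariant : List (Pivoted n) → Set
  BasisInvariant es = Echelon es × All (Orthogonal w) es

  certified-sound : ∀ {es} i j → BasisInvariant es → IsZero (reduce es (difference i j)) → wt i ≡ wt j
  certified-sound {es} i j ((_ , pivots≢0) , w⊥es) r≡0 = ℤ.i-j≡0⇒i≡j (wt i) (wt j) (begin
    wt i ℤ.- wt j       ≡⟨ ∙-difference i j ⟨
    w ∙ difference i j  ≡⟨ reduce-orthogonal⁻ w es (difference i j) w⊥es pivots≢0 (∙-zeroʳ w _ r≡0) ⟩
    0ℤ                  ∎)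
    where open ≡-Reasoning

  difference-orthogonal : ∀ i j → wt i ≡ wt j → w ∙ difference i j ≡ 0ℤ
  difference-orthogonal i j i≈j = trans (∙-difference i j) (ℤ.i≡j⇒i-j≡0 i≈j)

  Invariant : State → Set
  Invariant (es , cs) = BasisInvariant es × Sorted cs × All Homogeneous cs

  -- The truncated "number of classes − 1" reflects that the first class is created without a query.
  Φ : State → ℕ
  Φ (es , cs) = length es + (length cs ∸ 1)

  potential-step : ∀ {q x y} K → q ℕ.≤ K → y ≡ suc x → q + x * K ℕ.≤ y * K
  potential-step K q≤K refl = ℕ.+-monoˡ-≤ _ q≤K

  module Amortized (K : ℕ) (depth≤K : ∀ cs → Sorted cs → searchDepth (length cs) ℕ.≤ K) where

    record Advances (is : List Idx) (s s′ : State) (q : ℕ) : Set where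
      field
        invariant   : Invariant s′
        permutation : flatten (proj₂ s′) ↭ is ++ flatten (proj₂ s)
        amortized   : q + Φ s * K ℕ.≤ Φ s′ * K

    advances-by-search : ∀ {i es cs} → ¬ Any (λ c → IsZero (reduce es (difference i (rep c)))) cs →
                         Invariant (es , cs) → ∀ cs′ r q → Inserted i cs (cs′ , r) → q ℕ.≤ searchDepth (length cs) →
                         Advances [ i ] (es , cs) (newBasis es i r , cs′) q
    advances-by-search {es = es} {cs} _ (basis , sorted , _) cs′ nothing q ins q≤ = record
      { invariant   = basis , I.sorted , I.homogeneous
      ; permutation = I.permutation
      ; amortized   = amortized cs sorted q≤ I.grows
      }
      where
      module I = Inserted ins
      amortized : ∀ cs → Sorted cs → q ℕ.≤ searchDepth (length cs) → length cs′ ≡ suc (length cs) →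
                  q + Φ (es , cs) * K ℕ.≤ Φ (es , cs′) * K
      amortized []       _      z≤n grows rewrite grows = ℕ.≤-refl
      amortized (c ∷ cs) sorted q≤  grows rewrite grows =
        potential-step K (ℕ.≤-trans q≤ (depth≤K (c ∷ cs) sorted)) (ℕ.+-suc (length es) (length cs))
    advances-by-search {i} {es} {cs} uncertified (basis , sorted , _) cs′ (just r) q ins q≤ = record
      { invariant   = (extend-echelon d echelon , extend-orthogonal w d w⊥es (difference-orthogonal i r i≈r))
                      , I.sorted , I.homogeneous
      ; permutation = I.permutation
      ; amortized   = potential-step K (ℕ.≤-trans q≤ (depth≤K cs sorted))
                        (cong₂ _+_ (extend-length es d r-uncertified) (cong (_∸ 1) I.grows))
      }
      where
      module I = Inserted ins
      d = difference i r
      echelon = proj₁ basis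
      w⊥es = proj₂ basis
      i≈r = proj₁ I.joined
      r-uncertified : ¬ IsZero (reduce es d)
      r-uncertified = proj₂ I.joined (λ j → ¬ IsZero (reduce es (difference i j))) (All.¬Any⇒All¬ cs uncertified)

    insert-advances : ∀ i s → Invariant s → Advances [ i ] s (eval (insert i s)) (queries (insert i s))
    insert-advances i (es , cs) inv@(basis , sorted , homogeneous)
      with any? (λ c → isZero? (reduce es (difference i (rep c)))) cs
    ... | yes certified = record
      { invariant   = basis , I.sorted , I.homogeneous
      ; permutation = I.permutation
      ; amortized   = ℕ.≤-reflexive (cong (λ L → (length es + (L ∸ 1)) * K) (sym I.grows))
      }
      where module I = Inserted (joinAt-inserted i cs certified (certified-sound i _ basis) sorted homogeneous)
    ... | no uncertified =
      subst₂ (Advances [ i ] (es , cs)) (sym (eval->>= search _)) (sym (queries-map search _))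
        (advances-by-search uncertified inv _ _ (queries search)
          (binaryInsert-correct (length cs) i cs ℕ.≤-refl sorted homogeneous)
          (binaryInsert-queries (length cs) i cs ℕ.≤-refl))
      where search = binaryInsert (length cs) i cs

    advances-∷ : ∀ {i is s s′ s″ q q′} → Advances [ i ] s s′ q → Advances is s′ s″ q′ →
                 Advances (i ∷ is) s s″ (q + q′)
    advances-∷ {i} {is} {s} {s′} {s″} {q} {q′} first rest = record
      { invariant   = R.invariant
      ; permutation = ↭-trans R.permutation
                        (↭-trans (↭.++⁺ˡ is A.permutation) (↭.shift i is (flatten (proj₂ s))))
      ; amortized   = begin
          q + q′ + Φ s * K   ≡⟨ cong (_+ Φ s * K) (ℕ.+-comm q q′) ⟩
          q′ + q + Φ s * K   ≡⟨ ℕ.+-assoc q′ q _ ⟩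
          q′ + (q + Φ s * K) ≤⟨ ℕ.+-monoʳ-≤ q′ A.amortized ⟩
          q′ + Φ s′ * K      ≤⟨ R.amortized ⟩
          Φ s″ * K           ∎
      }
      where
      module A = Advances first
      module R = Advances rest
      open ℕ.≤-Reasoning

    insertAll-advances : ∀ is s → Invariant s → Advances is s (eval (insertAll is s)) (queries (insertAll is s))
    insertAll-advances []       s inv = record { invariant = inv ; permutation = ↭-refl ; amortized = ℕ.≤-refl }
    insertAll-advances (i ∷ is) s inv =
      subst₂ (Advances (i ∷ is) s) (sym (eval->>= (insert i s) (insertAll is)))
        (sym (queries->>= (insert i s) (insertAll is)))
        (advances-∷ first (insertAll-advances is (eval (insert i s)) (Advances.invariant first)))
      where first = insert-advances i s inv

  C : ℕ
  C = distinctWeights F w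

  sorted-length≤ : ∀ cs → Sorted cs → length cs ℕ.≤ C
  sorted-length≤ cs sorted = begin
    length cs                  ≡⟨ length-map (wt ∘ rep) cs ⟨
    length (map (wt ∘ rep) cs) ≤⟨ Unique-⊆⇒length≤ distinct realized ⟩
    C                          ∎
    where
    open ℕ.≤-Reasoning
    distinct : Unique (map (wt ∘ rep) cs)
    distinct = AllPairs.map⁺ (AllPairs.map (λ c<d c≈d → ℤ.<-irrefl c≈d c<d) sorted)
    realized : map (wt ∘ rep) cs ⊆ deduplicate ℤ._≟_ (map (weight w) F)
    realized x∈ with _ , _ , refl ← ∈-map⁻ (wt ∘ rep) x∈ =
      ∈-deduplicate⁺ ℤ._≟_ (∈-map⁺ (weight w) (∈-lookup _))

  constant-sorted : ∀ {t xs} → All (λ x → wt x ≡ t) xs → AllPairs (λ x y → wt x ℤ.≤ wt y) xs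
  constant-sorted []           = []
  constant-sorted (x≈t ∷ xs≈t) = All.map (λ y≈t → ℤ.≤-reflexive (trans x≈t (sym y≈t))) xs≈t ∷ constant-sorted xs≈t

  below-flatten : ∀ {t} cs → All (λ d → t ℤ.< wt (rep d)) cs → All Homogeneous cs →
                  All (λ y → t ℤ.≤ wt y) (flatten cs)
  below-flatten cs t<cs homogeneous = All.concat⁺ (All.map⁺ (All.zipWith below-members (t<cs , homogeneous)))
    where
    below-members : ∀ {t d} → t ℤ.< wt (rep d) × Homogeneous d → All (λ y → t ℤ.≤ wt y) (members d)
    below-members (t<d , y≈d) = ℤ.<⇒≤ t<d ∷ All.map (λ y≈d → subst (_ ℤ.≤_) (sym y≈d) (ℤ.<⇒≤ t<d)) y≈d

  flatten-sorted : ∀ cs → Sorted cs → All Homogeneous cs → AllPairs (λ x y → wt x ℤ.≤ wt y) (flatten cs)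
  flatten-sorted []       []                []                           = []
  flatten-sorted (c ∷ cs) (c≺cs ∷ sorted) (homogeneous-c ∷ homogeneous) =
    AllPairs.++⁺ (constant-sorted c-members) (flatten-sorted cs sorted homogeneous)
      (All.map (λ x≈c → All.map (subst (ℤ._≤ _) (sym x≈c)) (below-flatten cs c≺cs homogeneous)) c-members)
    where
    c-members : All (λ x → wt x ≡ wt (rep c)) (members c)
    c-members = refl ∷ homogeneous-c

  K : ℕ
  K = suc ⌊log₂ C ⌋

  depth≤K : ∀ cs → Sorted cs → searchDepth (length cs) ℕ.≤ K
  depth≤K cs sorted = ℕ.≤-trans (searchDepth-mono-≤ (sorted-length≤ cs sorted)) (searchDepth≤ C)
    where
    searchDepth≤ : ∀ L → searchDepth L ℕ.≤ suc ⌊log₂ L ⌋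
    searchDepth≤ zero    = z≤n
    searchDepth≤ (suc L) = ℕ.≤-refl

  open Amortized K depth≤K

  module Final = Advances (insertAll-advances (allFin (length F)) ([] , []) (((([] , []) , []) , [] , [])))

  eval-sortFamily : eval sortFamily ≡ map set (flatten (proj₂ (eval classify)))
  eval-sortFamily = eval->>= classify _

  sortFamily-permutation : eval sortFamily ↭ F
  sortFamily-permutation = subst (_↭ F) (sym eval-sortFamily)
    (subst (map set (flatten (proj₂ (eval classify))) ↭_) all-sets (↭.map⁺ set Final.permutation))
    where
    all-sets : map set (allFin (length F) ++ []) ≡ F
    all-sets = begin
      map set (allFin (length F) ++ []) ≡⟨ cong (map set) (++-identityʳ (allFin (length F))) ⟩
      map set (allFin (length F))       ≡⟨ map-tabulate (λ i → i) set ⟩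
      tabulate set                      ≡⟨ tabulate-lookup F ⟩
      F                                 ∎
      where open ≡-Reasoning

  sortFamily-sorted : Linked (λ S S′ → weight w S ℤ.≤ weight w S′) (eval sortFamily)
  sortFamily-sorted rewrite eval-sortFamily =
    let _ , sorted , homogeneous = Final.invariant
    in AllPairs⇒Linked (AllPairs.map⁺ (flatten-sorted _ sorted homogeneous))

  sortFamily-queries : queries sortFamily ℕ.≤ (n + (C ∸ 1)) * K
  sortFamily-queries = begin
    queries sortFamily       ≡⟨ queries-map classify _ ⟩
    queries classify         ≤⟨ ℕ.m≤m+n _ 0 ⟩
    queries classify + 0     ≤⟨ Final.amortized ⟩
    Φ (eval classify) * K    ≤⟨ ℕ.*-monoˡ-≤ K (ℕ.+-mono-≤ (echelon-length≤ echelon)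
                                                (ℕ.∸-monoˡ-≤ 1 (sorted-length≤ _ sorted))) ⟩
    (n + (C ∸ 1)) * K        ∎
    where
    open ℕ.≤-Reasoning
    echelon = proj₁ (proj₁ Final.invariant)
    sorted  = proj₁ (proj₂ Final.invariant)

weight-bound : ∀ (w : Vector ℤ n) B → (∀ e → ℤ.∣ w e ∣ ℕ.≤ B) → ∀ S → ℤ.∣ weight w S ∣ ℕ.≤ n * B
weight-bound w B w≤B []      = z≤n
weight-bound w B w≤B (b ∷ S) = ℕ.≤-trans (ℤ.∣i+j∣≤∣i∣+∣j∣ (if b then head w else 0ℤ) (weight (tail w) S))
  (ℕ.+-mono-≤ (head≤ b) (weight-bound (tail w) B (w≤B ∘ fsuc) S))
  where
  head≤ : ∀ b → ℤ.∣ (if b then head w else 0ℤ) ∣ ℕ.≤ B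
  head≤ true  = w≤B fzero
  head≤ false = z≤n

integersWithin : ℕ → List ℤ
integersWithin M = map ℤ.+_ (upTo (suc M)) ++ map ℤ.-[1+_] (upTo M)

length-integersWithin : ∀ M → length (integersWithin M) ≡ suc (M + M)
length-integersWithin M = begin
  length (integersWithin M)
    ≡⟨ length-++ (map ℤ.+_ (upTo (suc M))) ⟩
  length (map ℤ.+_ (upTo (suc M))) + length (map ℤ.-[1+_] (upTo M))
    ≡⟨ cong₂ _+_ (length-map ℤ.+_ (upTo (suc M))) (length-map ℤ.-[1+_] (upTo M)) ⟩
  length (upTo (suc M)) + length (upTo M)
    ≡⟨ cong₂ _+_ (length-upTo (suc M)) (length-upTo M) ⟩
  suc (M + M)
    ∎
  where open ≡-Reasoning

∈-integersWithin : ∀ M x → ℤ.∣ x ∣ ℕ.≤ M → x ∈ integersWithin M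
∈-integersWithin M (ℤ.+ a)     a≤M = ∈-++⁺ˡ (∈-map⁺ ℤ.+_ (∈-upTo⁺ (s≤s a≤M)))
∈-integersWithin M ℤ.-[1+ a ] a<M = ∈-++⁺ʳ (map ℤ.+_ (upTo (suc M))) (∈-map⁺ ℤ.-[1+_] (∈-upTo⁺ a<M))

distinctWeights-bound : ∀ (F : List (Subset n)) w B → (∀ e → ℤ.∣ w e ∣ ℕ.≤ B) →
                        distinctWeights F w ℕ.≤ suc (n * B + n * B)
distinctWeights-bound {n} F w B w≤B = begin
  distinctWeights F w                ≤⟨ Unique-⊆⇒length≤ (deduplicate-! ℤ._≟_ (map (weight w) F)) within ⟩
  length (integersWithin (n * B))    ≡⟨ length-integersWithin (n * B) ⟩
  suc (n * B + n * B)                ∎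
  where
  open ℕ.≤-Reasoning
  within : deduplicate ℤ._≟_ (map (weight w) F) ⊆ integersWithin (n * B)
  within x∈ with S , _ , refl ← ∈-map⁻ (weight w) (∈-deduplicate⁻ ℤ._≟_ (map (weight w) F) x∈) =
    ∈-integersWithin (n * B) (weight w S) (weight-bound w B w≤B S)

range-cost-bound : ∀ M m C → m ℕ.≤ M → C ℕ.≤ suc (M + M) →
                   (m + (C ∸ 1)) * suc ⌊log₂ C ⌋ ℕ.≤ 9 * M * suc ⌊log₂ M ⌋
range-cost-bound zero    _ C z≤n C≤1 rewrite ℕ.m≤n⇒m∸n≡0 C≤1 = z≤n
range-cost-bound M@(suc _) m C m≤M C≤ = begin
  (m + (C ∸ 1)) * suc ⌊log₂ C ⌋          ≤⟨ ℕ.*-mono-≤ (ℕ.+-mono-≤ m≤M (ℕ.∸-monoˡ-≤ 1 C≤)) log≤ ⟩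
  (M + (M + M)) * (3 * suc ⌊log₂ M ⌋)    ≡⟨ solve 2 (λ M X → (M :+ (M :+ M)) :* (con 3 :* X) := con 9 :* M :* X)
                                               refl M (suc ⌊log₂ M ⌋) ⟩
  9 * M * suc ⌊log₂ M ⌋                  ∎
  where
  open ℕ.≤-Reasoning
  open ℕ-Solver.+-*-Solver
  C≤4M : C ℕ.≤ 2 * (2 * M)
  C≤4M = begin
    C                   ≤⟨ C≤ ⟩
    1 + (M + M)         ≤⟨ ℕ.+-monoˡ-≤ (M + M) (s≤s z≤n) ⟩
    M + (M + M)         ≤⟨ ℕ.m≤n+m (M + (M + M)) M ⟩
    M + (M + (M + M))   ≡⟨ solve 1 (λ M → M :+ (M :+ (M :+ M)) := con 2 :* (con 2 :* M)) refl M ⟩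
    2 * (2 * M)         ∎
  log≤ : suc ⌊log₂ C ⌋ ℕ.≤ 3 * suc ⌊log₂ M ⌋
  log≤ = begin
    suc ⌊log₂ C ⌋               ≤⟨ s≤s (⌊log₂⌋-mono-≤ C≤4M) ⟩
    suc ⌊log₂ (2 * (2 * M)) ⌋   ≡⟨ cong suc (⌊log₂[2*b]⌋≡1+⌊log₂b⌋ (2 * M)) ⟩
    2 + ⌊log₂ (2 * M) ⌋         ≡⟨ cong (2 +_) (⌊log₂[2*b]⌋≡1+⌊log₂b⌋ M) ⟩
    3 + ⌊log₂ M ⌋               ≤⟨ ℕ.+-monoʳ-≤ 3 (ℕ.m≤n*m ⌊log₂ M ⌋ 3) ⟩
    3 + 3 * ⌊log₂ M ⌋           ≡⟨ ℕ.*-suc 3 ⌊log₂ M ⌋ ⟨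
    3 * suc ⌊log₂ M ⌋           ∎

sortingTree : (F : List (Subset n)) → Tree F
sortingTree F = Algorithm.toTree F (Algorithm.sortFamily F)

module _ (F : List (Subset n)) (w : Vector ℤ n) where
  open Algorithm F using (sortFamily)
  open Analysis F w

  sortingTree-permutation : run (sortingTree F) w ↭ F
  sortingTree-permutation = subst (_↭ F) (sym (run-toTree sortFamily)) sortFamily-permutation

  sortingTree-sorted : Linked (λ S S′ → weight w S ℤ.≤ weight w S′) (run (sortingTree F) w)
  sortingTree-sorted = subst (Linked _) (sym (run-toTree sortFamily)) sortFamily-sorted

  sortingTree-cost : cost (sortingTree F) w ℕ.≤
                     (n + (distinctWeights F w ∸ 1)) * suc ⌊log₂ distinctWeights F w ⌋
  sortingTree-cost = subst (ℕ._≤ (n + (C ∸ 1)) * K) (sym (cost-toTree sortFamily)) sortFamily-queries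

mainTheorem3 : Σ ℕ λ c → (n : ℕ) → (F : List (Subset n)) → Unique F →
    Σ (Tree F) λ T → (w : Fin n → ℤ) →
      (run T w ↭ F)
      × Linked (λ S S′ → weight w S ℤ.≤ weight w S′) (run T w)
      × cost T w ℕ.≤ c * (n + length (deduplicate ℤ._≟_ (map (weight w) F)))
                     * (1 + ⌊log₂ (length (deduplicate ℤ._≟_ (map (weight w) F))) ⌋)
      × ((B : ℕ) → 1 ℕ.≤ B → ((e : Fin n) → ℤ.∣ w e ∣ ℕ.≤ B) →
           cost T w ℕ.≤ c * (n * B) * (1 + ⌊log₂ (n * B) ⌋))
mainTheorem3 = 9 , λ n F _ → sortingTree F , λ w →
  let C = distinctWeights F w in
    sortingTree-permutation F w
  , sortingTree-sorted F w
  , ℕ.≤-trans (sortingTree-cost F w)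
      (ℕ.*-monoˡ-≤ _ (ℕ.≤-trans (ℕ.+-monoʳ-≤ n (ℕ.m∸n≤m C 1)) (ℕ.m≤n*m (n + C) 9)))
  , λ B 1≤B w≤B → ℕ.≤-trans (sortingTree-cost F w)
      (range-cost-bound (n * B) n C (ℕ.m≤m*n n B {{ℕ.>-nonZero 1≤B}}) (distinctWeights-bound F w B w≤B))
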